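{- For each integer $r\ge 2$ and each $n$ for which an $r$-regular graph on $n$ vertices exists (i.e. $n\ge r+1$ and $rn$ even), \[ q_r^-(n) \ge \frac2r - 2\sqrt{\frac6n}, \] where $q_r^-(n)=\min\{q^*(G): G \text{ an } r\text{ -regular graph on } n \text{ vertices}\}$.
   Context: For a graph $G$ with $m\ge 1$ edges and a partition $\mathcal A$ of $V(G)$, $q_{\mathcal A}(G)=\frac1m\sum_{A\in\mathcal A} e(A) - \frac{1}{4m^2}\sum_{A\in\mathcal A}\mathrm{vol}(A)^2$, where $e(A)$ is the number of edges inside $A$ and $\mathrm{vol}(A)$ the sum of degrees of vertices in $A$; the modularity is $q^*(G)=\max_{\mathcal A} q_{\mathcal A}(G)$. Graphs are simple. -}

module Defs where

open import Data.Nat as ℕ using (ℕ; zero; suc)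
open import Data.Integer using (+_)
open import Data.Rational as ℚ using (ℚ; _/_; 0ℚ)
open import Data.Fin using (Fin; _<_)
open import Data.Fin.Properties using (_<?_)
open import Data.List using (List; map; allFin)
open import Data.Nat.ListAction using (sum)
open import Data.Bool using (Bool; true; false; if_then_else_; _∧_)
open import Data.Product using (Σ; _×_)
open import Relation.Binary.PropositionalEquality using (_≡_)
open import Relation.Nullary.Decidable using (⌊_⌋)
open import Data.Fin using (_≟_)

Σ[_] : (n : ℕ) → (Fin n → ℕ) → ℕ
Σ[ n ] f = sum (map f (allFin n))

𝟙 : Bool → ℕ
𝟙 true  = 1
𝟙 false = 0

record Graph (n : ℕ) : Set where
  field
    adj   : Fin n → Fin n → Bool
    sym   : ∀ i j → adj i j ≡ adj j i
    irrefl : ∀ i → adj i i ≡ false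
open Graph public

module _ {n : ℕ} (G : Graph n) where

  degree : Fin n → ℕ
  degree i = Σ[ n ] (λ j → 𝟙 (adj G i j))

  edges : ℕ
  edges = Σ[ n ] (λ i → Σ[ n ] (λ j → 𝟙 (⌊ i <? j ⌋ ∧ adj G i j)))

  -- A partition of V(G) is given by a labelling f : Fin n → Fin n;
  -- the parts are the nonempty fibres f⁻¹(k). Every partition of an
  -- n-set has at most n parts, so every partition arises this way.
  Partition : Set
  Partition = Fin n → Fin n

  eIn : Partition → Fin n → ℕ
  eIn f k = Σ[ n ] (λ i → Σ[ n ] (λ j →
              𝟙 (⌊ i <? j ⌋ ∧ adj G i j ∧ ⌊ f i ≟ k ⌋ ∧ ⌊ f j ≟ k ⌋)))

  vol : Partition → Fin n → ℕ
  vol f k = Σ[ n ] (λ i → if ⌊ f i ≟ k ⌋ then degree i else 0)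

  -- q_A(G) = (1/m) Σ e(A) − (1/(4m²)) Σ vol(A)²   (defined as 0 if m = 0,
  -- a case that never occurs in the theorem)
  qPart : Partition → ℚ
  qPart f = go edges
    where
      go : ℕ → ℚ
      go zero    = 0ℚ
      go (suc k) = ((+ Σ[ n ] (eIn f)) / suc k)
                   ℚ.- ((+ Σ[ n ] (λ c → vol f c ℕ.* vol f c)) / (4 ℕ.* suc k ℕ.* suc k))

  IsModularity : ℚ → Set
  IsModularity q = Σ Partition (λ f → qPart f ≡ q) × (∀ f → qPart f ℚ.≤ q)

Regular : {n : ℕ} → ℕ → Graph n → Set
Regular {n} r G = ∀ i → degree G i ≡ r

{-# OPTIONS --safe #-}
-- Fix a spanning forest of G in which every tree is a component, and a threshold k. Call a
-- vertex light when its cluster (itself together with the clusters of its light children) has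
-- fewer than k vertices. Every heavy vertex spans a part made of its cluster, of size between k
-- and 1 + r(k − 1); the light top of each tree joins a heavy part hanging from it, or, if there
-- is none, is a whole component. Parts hanging from a heavy vertex are connected, so
-- e(A) ≥ |A| − 1, and there are at most n/k of them; a whole component has e(A) = r|A|/2 ≥ |A|.
-- With vol(A) = r|A| and |A| ≤ (r + 1)k this gives q ≥ 2/r − 2/(rk) − (r + 1)k/n, and taking
-- k largest with r(r + 1)k² ≤ 2n (or k = 1 when there is none) yields (2/r − q)² ≤ 24/n.
module Submission where

open import Defs renaming (sym to adj-sym; irrefl to adj-irrefl)
open import Data.Bool using (Bool; true; false; if_then_else_; _∧_; _∨_; not)
open import Data.Bool.Properties using (∧-zeroʳ; ∧-comm; ∨-identityʳ; ∨-zeroʳ)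
import Data.Bool.Properties as Bool
open import Data.Fin using (Fin; zero; suc; _≟_; _<?_; punchIn)
import Data.Fin.Properties as Fin
import Data.Integer as ℤ
import Data.Integer.Properties as ℤ
open import Data.List using (tabulate; _∷_; [])
open import Data.List.Properties using (map-tabulate)
open import Data.Maybe using (Maybe; just; nothing; fromMaybe; maybe′)
import Data.Maybe
open import Data.Nat as ℕ using (ℕ; zero; suc; _+_; _*_; _∸_; _≤_; _<_; z≤n; s≤s; pred)
open import Data.Nat.Divisibility using (_∣_)
import Data.Nat.ListAction as List
open import Data.Nat.Properties hiding (_≟_; _<?_)
open import Algebra.Properties.Semiring.Sum +-*-semiring
  using (sum; sum-cong-≗; sum-replicate-zero; sum-remove; ∑-distrib-+; ∑-comm; *-distribˡ-sum; *-distribʳ-sum)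
open import Data.Nat.Tactic.RingSolver using (solve-∀; solve)
open import Data.Product using (∃; _×_; _,_; proj₁; proj₂)
open import Data.Rational as ℚ using (ℚ; _/_; 0ℚ; toℚᵘ)
import Data.Rational.Properties as ℚ
open import Data.Rational.Properties using (toℚᵘ-fromℚᵘ; toℚᵘ-cancel-≤; toℚᵘ-injective; toℚᵘ-homo-+; toℚᵘ-homo-*)
open import Data.Rational.Solver using () renaming (module +-*-Solver to ℚ-Solver)
open import Data.Rational.Unnormalised as ℚᵘ using (mkℚᵘ; *≤*) renaming (_≃_ to _≃ᵘ_)
import Data.Rational.Unnormalised.Properties as ℚᵘ
open import Data.Sum using (_⊎_; inj₁; inj₂)
open import Function using (_∘_; id)
open import Relation.Binary.Definitions using (tri<; tri≈; tri>)
open import Relation.Binary.PropositionalEquality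
open import Relation.Nullary using (¬_; yes; no; contradiction)
open import Relation.Nullary.Decidable using (Dec; _×-dec_; ⌊_⌋; dec-true; dec-false; isYes≗does)

-- Finite sums and counting

⌊⌋-true : ∀ {A : Set} (a? : Dec A) → A → ⌊ a? ⌋ ≡ true
⌊⌋-true a? a = trans (isYes≗does a?) (dec-true a? a)

⌊⌋-false : ∀ {A : Set} (a? : Dec A) → ¬ A → ⌊ a? ⌋ ≡ false
⌊⌋-false a? ¬a = trans (isYes≗does a?) (dec-false a? ¬a)

Σ≡sum : ∀ n (f : Fin n → ℕ) → Σ[ n ] f ≡ sum f
Σ≡sum n f = trans (cong List.sum (map-tabulate id f)) (go n f)
  where
  go : ∀ n (f : Fin n → ℕ) → List.sum (tabulate f) ≡ sum f
  go zero    f = refl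
  go (suc n) f = cong (f zero +_) (go n (f ∘ suc))

sum-mono-≤ : ∀ {n} {f g : Fin n → ℕ} → (∀ i → f i ≤ g i) → sum f ≤ sum g
sum-mono-≤ {zero}  f≤g = z≤n
sum-mono-≤ {suc n} f≤g = +-mono-≤ (f≤g zero) (sum-mono-≤ (f≤g ∘ suc))

sum-const : ∀ n c → sum {n} (λ _ → c) ≡ n * c
sum-const zero    c = refl
sum-const (suc n) c = cong (c +_) (sum-const n c)

sum-single : ∀ {n} (f : Fin n → ℕ) a → (∀ j → j ≢ a → f j ≡ 0) → sum f ≡ f a
sum-single {suc n} f a off = begin
  sum f                        ≡⟨ sum-remove f ⟩
  f a + sum (λ j → f (punchIn a j)) ≡⟨ cong (f a +_) (sum-cong-≗ (λ j → off _ (Fin.punchInᵢ≢i a j))) ⟩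
  f a + sum {n} (λ _ → 0)      ≡⟨ cong (f a +_) (sum-replicate-zero n) ⟩
  f a + 0                      ≡⟨ +-identityʳ (f a) ⟩
  f a                          ∎
  where open ≡-Reasoning

sum-δ : ∀ {n} (g : Fin n → ℕ) v → sum (λ i → if ⌊ i ≟ v ⌋ then g i else 0) ≡ g v
sum-δ g v = trans (sum-single _ v off) (cong (λ b → if b then g v else 0) (⌊⌋-true (v ≟ v) refl))
  where
  off : ∀ j → j ≢ v → (if ⌊ j ≟ v ⌋ then g j else 0) ≡ 0
  off j j≢v rewrite ⌊⌋-false (j ≟ v) j≢v = refl

count : ∀ {n} → (Fin n → Bool) → ℕ
count b = sum (λ i → 𝟙 (b i))

𝟙≤1 : ∀ b → 𝟙 b ≤ 1
𝟙≤1 true  = s≤s z≤n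
𝟙≤1 false = z≤n

∧-true : ∀ {a b} → a ∧ b ≡ true → a ≡ true × b ≡ true
∧-true {true} h = refl , h

not-∧-self : ∀ a → 𝟙 (not a ∧ a) ≡ 0
not-∧-self true  = refl
not-∧-self false = refl

𝟙-∧ : ∀ a b → 𝟙 (a ∧ b) ≡ 𝟙 a * 𝟙 b
𝟙-∧ true  b = sym (+-identityʳ (𝟙 b))
𝟙-∧ false b = refl

count-∧ : ∀ {n} b (g : Fin n → Bool) → count (λ i → b ∧ g i) ≡ 𝟙 b * count g
count-∧ true      g = sym (+-identityʳ (count g))
count-∧ {n} false g = sum-replicate-zero n

count-all : ∀ {n} {b : Fin n → Bool} → (∀ v → b v ≡ true) → count b ≡ n
count-all {n} all = trans (sum-cong-≗ (λ v → cong 𝟙 (all v))) (trans (sum-const n 1) (*-identityʳ n))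

count-full : ∀ {n} (b : Fin n → Bool) → count b ≡ n → ∀ v → b v ≡ true
count-full {n} b full v with b v in bv
... | true  = refl
... | false = contradiction full (<⇒≢ (begin-strict
  count b                                       <⟨ m<m+n (count b) (s≤s z≤n) ⟩
  count b + 1                                   ≡⟨ cong (count b +_) (sum-δ (λ _ → 1) v) ⟨
  sum (λ i → 𝟙 (b i)) + sum δ                   ≡⟨ ∑-distrib-+ _ δ ⟨
  sum (λ i → 𝟙 (b i) + δ i)                     ≤⟨ sum-mono-≤ disjoint ⟩
  count {n} (λ _ → true)                        ≡⟨ count-all (λ _ → refl) ⟩
  n                                             ∎))
  where
  open ≤-Reasoning
  δ : Fin n → ℕ
  δ i = if ⌊ i ≟ v ⌋ then 1 else 0
  disjoint : ∀ i → 𝟙 (b i) + δ i ≤ 1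
  disjoint i with i ≟ v
  ... | yes refl rewrite bv = ≤-refl
  ... | no _    = ≤-trans (≤-reflexive (+-identityʳ _)) (𝟙≤1 (b i))

handshake : ∀ {n} (B : Fin n → Fin n → Bool) → (∀ i j → B i j ≡ B j i) → (∀ i → B i i ≡ false) →
            sum (λ i → count (B i)) ≡ 2 * sum (λ i → count (λ j → ⌊ i <? j ⌋ ∧ B i j))
handshake {n} B B-sym B-irrefl = begin
  sum (λ i → count (B i))                         ≡⟨ sum-cong-≗ (λ i → trans (sum-cong-≗ (split i)) (∑-distrib-+ {n} _ _)) ⟩
  sum (λ i → sum (U i) + sum (λ j → U j i))       ≡⟨ ∑-distrib-+ {n} _ _ ⟩
  sum (λ i → sum (U i)) + sum (λ i → sum (λ j → U j i)) ≡⟨ cong (sum (λ i → sum (U i)) +_) (∑-comm (λ i j → U j i)) ⟩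
  sum (λ i → sum (U i)) + sum (λ i → sum (U i))   ≡⟨ cong (sum (λ i → sum (U i)) +_) (+-identityʳ _) ⟨
  2 * sum (λ i → sum (U i))                       ∎
  where
  open ≡-Reasoning
  U : Fin n → Fin n → ℕ
  U i j = 𝟙 (⌊ i <? j ⌋ ∧ B i j)
  split : ∀ i j → 𝟙 (B i j) ≡ U i j + U j i
  split i j with Fin.<-cmp i j
  ... | tri< i<j _ j≮i rewrite ⌊⌋-true (i <? j) i<j | ⌊⌋-false (j <? i) j≮i = sym (+-identityʳ _)
  ... | tri≈ _ refl _  rewrite B-irrefl i | ∧-zeroʳ ⌊ i <? i ⌋ = refl
  ... | tri> i≮j _ j<i rewrite ⌊⌋-false (i <? j) i≮j | ⌊⌋-true (j <? i) j<i = cong 𝟙 (B-sym i j)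

-- Spanning forests

record SpanningForest {n} (G : Graph n) : Set where
  field
    rank        : Fin n → ℕ
    parent      : Fin n → Maybe (Fin n)
    root        : Fin n → Fin n
    rank<n      : ∀ v → rank v < n
    parent-adj  : ∀ {v p} → parent v ≡ just p → adj G v p ≡ true
    parent-rank : ∀ {v p} → parent v ≡ just p → rank p < rank v
    parent-root : ∀ {v p} → parent v ≡ just p → root v ≡ root p
    orphan-root : ∀ {v} → parent v ≡ nothing → root v ≡ v
    adj-root    : ∀ {u v} → adj G u v ≡ true → root u ≡ root v

module Search {n} (G : Graph n) where

  OnFrontier : (Fin n → Bool) → Fin n → Set
  OnFrontier visited u = visited u ≡ true × ∃ λ x → visited x ≡ false × adj G u x ≡ true

  record State (t : ℕ) : Set where
    field
      visited       : Fin n → Bool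
      rank          : Fin n → ℕ
      parent        : Fin n → Maybe (Fin n)
      root          : Fin n → Fin n
      visited-count : count visited ≡ t
      rank<t        : ∀ {v} → visited v ≡ true → rank v < t
      parent-ok     : ∀ {v p} → visited v ≡ true → parent v ≡ just p →
                      visited p ≡ true × adj G v p ≡ true × rank p < rank v × root v ≡ root p
      orphan-root   : ∀ {v} → visited v ≡ true → parent v ≡ nothing → root v ≡ v
      adj-root      : ∀ {u w} → visited u ≡ true → visited w ≡ true → adj G u w ≡ true → root u ≡ root w
      frontier-root : ∀ {u u'} → OnFrontier visited u → OnFrontier visited u' → root u ≡ root u'

  empty : State 0
  empty = record
    { visited = λ _ → false ; rank = λ _ → 0 ; parent = λ _ → nothing ; root = id
    ; visited-count = sum-replicate-zero n
    ; rank<t = λ () ; parent-ok = λ () ; orphan-root = λ () ; adj-root = λ () ; frontier-root = λ () }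

  _[_≔_] : {A : Set} → (Fin n → A) → Fin n → A → Fin n → A
  (f [ x ≔ a ]) v = if ⌊ v ≟ x ⌋ then a else f v

  count-insert : ∀ {t} (visited : Fin n → Bool) {x} → visited x ≡ false → count visited ≡ t →
                 count (visited [ x ≔ true ]) ≡ suc t
  count-insert {t} visited {x} unvisited counted = begin
    count (visited [ x ≔ true ])                               ≡⟨ sum-cong-≗ split ⟩
    sum (λ v → 𝟙 (visited v) + (if ⌊ v ≟ x ⌋ then 1 else 0))   ≡⟨ ∑-distrib-+ {n} _ _ ⟩
    count visited + sum (λ v → if ⌊ v ≟ x ⌋ then 1 else 0)     ≡⟨ cong₂ _+_ counted (sum-δ (λ _ → 1) x) ⟩
    t + 1                                                      ≡⟨ +-comm t 1 ⟩
    suc t                                                      ∎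
    where
    open ≡-Reasoning
    split : ∀ v → 𝟙 ((visited [ x ≔ true ]) v) ≡ 𝟙 (visited v) + (if ⌊ v ≟ x ⌋ then 1 else 0)
    split v with v ≟ x
    ... | yes refl rewrite unvisited = refl
    ... | no _     = sym (+-identityʳ _)

  module _ {t} (s : State t) where
    open State s

    -- Every old frontier vertex must lie in the tree that receives x (vacuous for a new root).
    insert : ∀ x (px : Maybe (Fin n)) ρ → visited x ≡ false →
             (∀ {p} → px ≡ just p → visited p ≡ true × adj G x p ≡ true × root p ≡ ρ) →
             (px ≡ nothing → ρ ≡ x) →
             (∀ {u} → OnFrontier visited u → root u ≡ ρ) →
             State (suc t)
    insert x px ρ unvisited parent-x orphan-x frontier-x = record
      { visited = visited′ ; rank = rank [ x ≔ t ] ; parent = parent′ ; root = root′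
      ; visited-count = count-insert visited unvisited visited-count
      ; rank<t = rank<t′ ; parent-ok = parent-ok′ ; orphan-root = orphan-root′
      ; adj-root = adj-root′ ; frontier-root = λ hu hu′ → trans (frontier-root′ hu) (sym (frontier-root′ hu′)) }
      where
      visited′ = visited [ x ≔ true ]
      parent′  = parent [ x ≔ px ]
      root′    = root [ x ≔ ρ ]

      old : ∀ {v} → visited v ≡ true → ⌊ v ≟ x ⌋ ≡ false
      old {v} visited-v = ⌊⌋-false (v ≟ x) λ { refl → contradiction (trans (sym visited-v) unvisited) λ () }

      old-frontier : ∀ {u y} → visited u ≡ true → (visited [ x ≔ true ]) y ≡ false → adj G u y ≡ true →
                     OnFrontier visited u
      old-frontier {y = y} visited-u unvisited-y u~y with y ≟ x
      ... | no _ = visited-u , y , unvisited-y , u~y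

      rank<t′ : ∀ {v} → visited′ v ≡ true → (rank [ x ≔ t ]) v < suc t
      rank<t′ {v} h with v ≟ x
      ... | yes _ = ≤-refl
      ... | no _  = m<n⇒m<1+n (rank<t h)

      parent-ok′ : ∀ {v p} → visited′ v ≡ true → parent′ v ≡ just p →
                   visited′ p ≡ true × adj G v p ≡ true × (rank [ x ≔ t ]) p < (rank [ x ≔ t ]) v × root′ v ≡ root′ p
      parent-ok′ {v} {p} hv hp with v ≟ x
      ... | yes refl with visited-p , x~p , root-p ← parent-x hp rewrite old visited-p =
            visited-p , x~p , rank<t visited-p , sym root-p
      ... | no _ with visited-p , v~p , rank-p , root-vp ← parent-ok hv hp rewrite old visited-p =
            visited-p , v~p , rank-p , root-vp

      orphan-root′ : ∀ {v} → visited′ v ≡ true → parent′ v ≡ nothing → root′ v ≡ v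
      orphan-root′ {v} hv hp with v ≟ x
      ... | yes refl = orphan-x hp
      ... | no _     = orphan-root hv hp

      adj-root′ : ∀ {u w} → visited′ u ≡ true → visited′ w ≡ true → adj G u w ≡ true → root′ u ≡ root′ w
      adj-root′ {u} {w} hu hw u~w with u ≟ x | w ≟ x
      ... | yes refl | yes refl = refl
      ... | yes refl | no _     = sym (frontier-x (hw , x , unvisited , trans (adj-sym G w x) u~w))
      ... | no _     | yes refl = frontier-x (hu , x , unvisited , u~w)
      ... | no _     | no _     = adj-root hu hw u~w

      frontier-root′ : ∀ {u} → OnFrontier visited′ u → root′ u ≡ ρ
      frontier-root′ {u} (hu , y , hy , u~y) with u ≟ x
      ... | yes _ = refl
      ... | no _  = frontier-x (old-frontier hu hy u~y)

    attach : ∀ x p → visited x ≡ false → visited p ≡ true → adj G x p ≡ true → State (suc t)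
    attach x p unvisited-x visited-p x~p = insert x (just p) (root p) unvisited-x
      (λ { refl → visited-p , x~p , refl }) (λ ())
      (λ hu → frontier-root hu (visited-p , x , unvisited-x , trans (adj-sym G p x) x~p))

    new-root : ∀ x → visited x ≡ false → (∀ u → ¬ OnFrontier visited u) → State (suc t)
    new-root x unvisited-x no-frontier = insert x nothing x unvisited-x (λ ()) (λ _ → refl)
      (λ {u} hu → contradiction hu (no-frontier u))

    step : t < n → State (suc t)
    step t<n with Fin.any? (λ x → Fin.any? (λ p →
                    (visited x Bool.≟ false) ×-dec (visited p Bool.≟ true) ×-dec (adj G x p Bool.≟ true)))
    ... | yes (x , p , unvisited-x , visited-p , x~p) = attach x p unvisited-x visited-p x~p
    ... | no no-edge with Fin.any? (λ x → visited x Bool.≟ false)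
    ...   | yes (x , unvisited-x) = new-root x unvisited-x
            (λ u (hu , y , hy , u~y) → no-edge (y , u , hy , hu , trans (adj-sym G y u) u~y))
    ...   | no all-visited = contradiction (trans (sym visited-count) (count-all visited-all)) (<⇒≢ t<n)
      where
      visited-all : ∀ v → visited v ≡ true
      visited-all v with visited v in e
      ... | true  = refl
      ... | false = contradiction (v , e) all-visited

  run : ∀ t → t ≤ n → State t
  run zero    _   = empty
  run (suc t) t<n = step (run t (<⇒≤ t<n)) t<n

spanningForest : ∀ {n} (G : Graph n) → SpanningForest G
spanningForest {n} G = record
  { rank = rank ; parent = parent ; root = root
  ; rank<n      = λ v → rank<t (visited-all v)
  ; parent-adj  = λ {v} hp → proj₁ (proj₂ (parent-ok (visited-all v) hp))
  ; parent-rank = λ {v} hp → proj₁ (proj₂ (proj₂ (parent-ok (visited-all v) hp)))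
  ; parent-root = λ {v} hp → proj₂ (proj₂ (proj₂ (parent-ok (visited-all v) hp)))
  ; orphan-root = λ {v} → orphan-root (visited-all v)
  ; adj-root    = λ {u} {v} → adj-root (visited-all u) (visited-all v) }
  where
  open Search.State (Search.run G n ≤-refl)
  visited-all : ∀ v → visited v ≡ true
  visited-all = count-full visited visited-count

module _ {n} {G : Graph n} (F : SpanningForest G) where
  open SpanningForest F

  parent-induction : {P : Fin n → Set} → (∀ v → (∀ {p} → parent v ≡ just p → P p) → P v) → ∀ v → P v
  parent-induction {P} ind v = go (suc (rank v)) v ≤-refl
    where
    go : ∀ t v → rank v < t → P v
    go (suc t) v rank<t = ind v λ hp → go t _ (≤-trans (parent-rank hp) (≤-pred rank<t))

  child-induction : {P : Fin n → Set} → (∀ u → (∀ {w} → parent w ≡ just u → P w) → P u) → ∀ u → P u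
  child-induction {P} ind u = go (suc (n ∸ rank u)) u ≤-refl
    where
    go : ∀ t u → n ∸ rank u < t → P u
    go (suc t) u h = ind u λ {w} hw →
      go t w (≤-trans (∸-monoʳ-< (parent-rank hw) (<⇒≤ (rank<n w))) (≤-pred h))

  root-is-root : ∀ v → parent (root v) ≡ nothing × root (root v) ≡ root v
  root-is-root = parent-induction case-parent
    where
    case-parent : ∀ v → (∀ {p} → parent v ≡ just p → parent (root p) ≡ nothing × root (root p) ≡ root p) →
                  parent (root v) ≡ nothing × root (root v) ≡ root v
    case-parent v ih with parent v in hp
    ... | nothing rewrite orphan-root hp = hp , orphan-root hp
    ... | just p  rewrite parent-root hp = ih refl

  module Climb {X : Set} (top : X) (step : Fin n → Maybe X → X) where

    climbFor : ℕ → Fin n → X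
    climbFor zero    v = top
    climbFor (suc t) v = step v (Data.Maybe.map (climbFor t) (parent v))

    climbFor-stable : ∀ t t′ v → rank v < t → rank v < t′ → climbFor t v ≡ climbFor t′ v
    climbFor-stable (suc t) (suc t′) v h h′ with parent v in hp
    ... | nothing = refl
    ... | just p  = cong (step v ∘ just)
      (climbFor-stable t t′ p (≤-trans (parent-rank hp) (≤-pred h)) (≤-trans (parent-rank hp) (≤-pred h′)))

    climb : Fin n → X
    climb = climbFor n

    climb-unfold : ∀ v → climb v ≡ step v (Data.Maybe.map climb (parent v))
    climb-unfold v = climbFor-stable n (suc n) v (rank<n v) (m<n⇒m<1+n (rank<n v))

  childOf : Fin n → Fin n → Bool
  childOf w u = maybe′ (λ p → ⌊ p ≟ u ⌋) false (parent w)

  childOf-parent : ∀ {w u} → childOf w u ≡ true → parent w ≡ just u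
  childOf-parent {w} {u} h with parent w
  ... | just p with p ≟ u
  ...   | yes refl = refl

  childOf-asym : ∀ {w u} → childOf w u ≡ true → childOf u w ≡ false
  childOf-asym {w} {u} h with childOf u w in h′
  ... | false = refl
  ... | true  = contradiction (parent-rank (childOf-parent h)) (<⇒≯ (parent-rank (childOf-parent h′)))

-- Partitions of regular graphs

count-≟ : ∀ {n} (a : Fin n) → count (λ c → ⌊ a ≟ c ⌋) ≡ 1
count-≟ a = trans (sum-single _ a off) (cong 𝟙 (⌊⌋-true (a ≟ a) refl))
  where
  off : ∀ c → c ≢ a → 𝟙 ⌊ a ≟ c ⌋ ≡ 0
  off c c≢a rewrite ⌊⌋-false (a ≟ c) (c≢a ∘ sym) = refl

count-adj : ∀ {n r} (G : Graph n) → Regular r G → ∀ i → count (adj G i) ≡ r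
count-adj {n} G regular i = trans (sym (Σ≡sum n _)) (regular i)

edges-regular : ∀ {n r} (G : Graph n) → Regular r G → 2 * edges G ≡ n * r
edges-regular {n} {r} G regular = begin
  2 * edges G                                               ≡⟨ cong (2 *_) (trans (Σ≡sum n _) (sum-cong-≗ {n} (λ i → Σ≡sum n _))) ⟩
  2 * sum (λ i → count (λ j → ⌊ i <? j ⌋ ∧ adj G i j))      ≡⟨ handshake (adj G) (adj-sym G) (adj-irrefl G) ⟨
  sum (λ i → count (adj G i))                               ≡⟨ sum-cong-≗ (count-adj G regular) ⟩
  sum {n} (λ _ → r)                                         ≡⟨ sum-const n r ⟩
  n * r                                                     ∎
  where open ≡-Reasoning

edges-suc : ∀ {n r} (G : Graph (suc n)) → Regular (suc r) G → ∃ λ m → edges G ≡ suc m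
edges-suc G regular with edges G in e
... | suc m = m , refl
... | zero  = contradiction (trans (sym (cong (2 *_) e)) (edges-regular G regular)) λ ()

module _ {n} (G : Graph n) (f : Partition G) where

  partSize : Fin n → ℕ
  partSize c = count (λ i → ⌊ f i ≟ c ⌋)

  sum-partSize : sum partSize ≡ n
  sum-partSize = begin
    sum partSize                          ≡⟨ ∑-comm (λ c i → 𝟙 ⌊ f i ≟ c ⌋) ⟩
    sum (λ i → count (λ c → ⌊ f i ≟ c ⌋)) ≡⟨ sum-cong-≗ (count-≟ ∘ f) ⟩
    sum {n} (λ _ → 1)                     ≡⟨ trans (sum-const n 1) (*-identityʳ n) ⟩
    n                                     ∎
    where open ≡-Reasoning

  bothIn : Fin n → Fin n → Fin n → Bool
  bothIn c i j = ⌊ f i ≟ c ⌋ ∧ ⌊ f j ≟ c ⌋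

  eIn-twice : ∀ c → 2 * eIn G f c ≡ sum (λ i → count (λ j → adj G i j ∧ bothIn c i j))
  eIn-twice c = sym (trans (handshake B B-sym B-irrefl) (cong (2 *_) (sym eIn-sum)))
    where
    B : Fin n → Fin n → Bool
    B i j = adj G i j ∧ bothIn c i j
    B-sym : ∀ i j → B i j ≡ B j i
    B-sym i j = cong₂ _∧_ (adj-sym G i j) (∧-comm ⌊ f i ≟ c ⌋ ⌊ f j ≟ c ⌋)
    B-irrefl : ∀ i → B i i ≡ false
    B-irrefl i rewrite adj-irrefl G i = refl
    eIn-sum : eIn G f c ≡ sum (λ i → count (λ j → ⌊ i <? j ⌋ ∧ B i j))
    eIn-sum = trans (Σ≡sum n _) (sum-cong-≗ {n} (λ i → Σ≡sum n _))

  module _ {r} (regular : Regular r G) where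

    vol-regular : ∀ c → vol G f c ≡ partSize c * r
    vol-regular c = begin
      vol G f c                                        ≡⟨ Σ≡sum n _ ⟩
      sum (λ i → if ⌊ f i ≟ c ⌋ then degree G i else 0) ≡⟨ sum-cong-≗ pointwise ⟩
      sum (λ i → 𝟙 ⌊ f i ≟ c ⌋ * r)                    ≡⟨ *-distribʳ-sum r (λ i → 𝟙 ⌊ f i ≟ c ⌋) ⟨
      partSize c * r                                   ∎
      where
      open ≡-Reasoning
      pointwise : ∀ i → (if ⌊ f i ≟ c ⌋ then degree G i else 0) ≡ 𝟙 ⌊ f i ≟ c ⌋ * r
      pointwise i with ⌊ f i ≟ c ⌋
      ... | true  = trans (regular i) (sym (+-identityʳ r))
      ... | false = refl

    sum-vol² : Σ[ n ] (λ c → vol G f c * vol G f c) ≡ r * r * sum (λ c → partSize c * partSize c)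
    sum-vol² = begin
      Σ[ n ] (λ c → vol G f c * vol G f c)          ≡⟨ Σ≡sum n _ ⟩
      sum (λ c → vol G f c * vol G f c)             ≡⟨ sum-cong-≗ (λ c → cong₂ _*_ (vol-regular c) (vol-regular c)) ⟩
      sum (λ c → partSize c * r * (partSize c * r)) ≡⟨ sum-cong-≗ (λ c → square-* (partSize c) r) ⟩
      sum (λ c → r * r * (partSize c * partSize c)) ≡⟨ *-distribˡ-sum (r * r) (λ c → partSize c * partSize c) ⟨
      r * r * sum (λ c → partSize c * partSize c)   ∎
      where
      open ≡-Reasoning
      square-* : ∀ a b → a * b * (a * b) ≡ b * b * (a * a)
      square-* = solve-∀

    closed-part : ∀ c → (∀ {i j} → f i ≡ c → adj G i j ≡ true → f j ≡ c) → partSize c * r ≤ 2 * eIn G f c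
    closed-part c closed = begin
      partSize c * r                                          ≡⟨ *-distribʳ-sum r (λ i → 𝟙 ⌊ f i ≟ c ⌋) ⟩
      sum (λ i → 𝟙 ⌊ f i ≟ c ⌋ * r)
        ≡⟨ sum-cong-≗ (λ i → cong (𝟙 ⌊ f i ≟ c ⌋ *_) (count-adj G regular i)) ⟨
      sum (λ i → 𝟙 ⌊ f i ≟ c ⌋ * count (adj G i))
        ≡⟨ sum-cong-≗ (λ i → *-distribˡ-sum (𝟙 ⌊ f i ≟ c ⌋) (λ j → 𝟙 (adj G i j))) ⟩
      sum (λ i → sum (λ j → 𝟙 ⌊ f i ≟ c ⌋ * 𝟙 (adj G i j)))   ≤⟨ sum-mono-≤ (λ i → sum-mono-≤ (pointwise i)) ⟩
      sum (λ i → count (λ j → adj G i j ∧ bothIn c i j))      ≡⟨ eIn-twice c ⟨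
      2 * eIn G f c                                           ∎
      where
      open ≤-Reasoning
      pointwise : ∀ i j → 𝟙 ⌊ f i ≟ c ⌋ * 𝟙 (adj G i j) ≤ 𝟙 (adj G i j ∧ bothIn c i j)
      pointwise i j with f i ≟ c | adj G i j in i~j
      ... | no _    | _     = z≤n
      ... | yes _   | false = z≤n
      ... | yes fic | true rewrite ⌊⌋-true (f j ≟ c) (closed fic i~j) = ≤-refl

module _ {n} {G : Graph n} (F : SpanningForest G) (f : Partition G) where
  open SpanningForest F

  parentInPart : Fin n → Bool
  parentInPart i = maybe′ (λ p → ⌊ f p ≟ f i ⌋) false (parent i)

  treeEdgesIn : Fin n → ℕ
  treeEdgesIn c = count (λ i → ⌊ f i ≟ c ⌋ ∧ parentInPart i)

  -- Each counted i contributes the edge {i, parent i}; none twice, as parenthood is asymmetric.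
  treeEdgesIn≤eIn : ∀ c → treeEdgesIn c ≤ eIn G f c
  treeEdgesIn≤eIn c = *-cancelˡ-≤ 2 (begin
    2 * treeEdgesIn c                                          ≡⟨ cong (treeEdgesIn c +_) (+-identityʳ _) ⟩
    treeEdgesIn c + treeEdgesIn c
      ≡⟨ cong₂ _+_ (sum-cong-≗ {n} out) (trans (sym (∑-comm X)) (sum-cong-≗ {n} out)) ⟨
    sum (λ i → sum (X i)) + sum (λ i → sum (λ j → X j i))      ≡⟨ ∑-distrib-+ {n} _ _ ⟨
    sum (λ i → sum (X i) + sum (λ j → X j i))                  ≡⟨ sum-cong-≗ {n} (λ i → ∑-distrib-+ {n} _ _) ⟨
    sum (λ i → sum (λ j → X i j + X j i))                      ≤⟨ sum-mono-≤ (λ i → sum-mono-≤ (pointwise i)) ⟩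
    sum (λ i → count (λ j → adj G i j ∧ bothIn G f c i j))     ≡⟨ eIn-twice G f c ⟨
    2 * eIn G f c                                              ∎)
    where
    open ≤-Reasoning
    X : Fin n → Fin n → ℕ
    X i j = 𝟙 (childOf F i j ∧ bothIn G f c i j)

    out : ∀ i → sum (X i) ≡ 𝟙 (⌊ f i ≟ c ⌋ ∧ parentInPart i)
    out i with parent i
    ... | nothing = trans (sum-replicate-zero n) (cong 𝟙 (sym (∧-zeroʳ _)))
    ... | just p  = trans (sum-single _ p off) at-p
      where
      off : ∀ j → j ≢ p → 𝟙 (⌊ p ≟ j ⌋ ∧ bothIn G f c i j) ≡ 0
      off j j≢p rewrite ⌊⌋-false (p ≟ j) (j≢p ∘ sym) = refl
      at-p : 𝟙 (⌊ p ≟ p ⌋ ∧ bothIn G f c i p) ≡ 𝟙 (⌊ f i ≟ c ⌋ ∧ ⌊ f p ≟ f i ⌋)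
      at-p rewrite ⌊⌋-true (p ≟ p) refl with f i ≟ c
      ... | yes refl = refl
      ... | no _     = refl

    pointwise : ∀ i j → X i j + X j i ≤ 𝟙 (adj G i j ∧ bothIn G f c i j)
    pointwise i j with childOf F i j in ij | childOf F j i in ji
    ... | true  | true  = contradiction (trans (sym ji) (childOf-asym F ij)) λ ()
    ... | true  | false rewrite parent-adj (childOf-parent F ij) = ≤-reflexive (+-identityʳ _)
    ... | false | true  rewrite adj-sym G i j | parent-adj (childOf-parent F ji) | ∧-comm ⌊ f i ≟ c ⌋ ⌊ f j ≟ c ⌋ = ≤-refl
    ... | false | false = z≤n

-- Cutting a spanning forest into clusters

-- A heavy cluster (at most 1 + r(k − 1) vertices) plus the light top of a tree (at most k − 1).
partBound : ℕ → ℕ → ℕ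
partBound r k = suc (r * pred k) + pred k

module Cutting {n} {G : Graph n} (F : SpanningForest G) (k : ℕ) where
  open SpanningForest F

  hanging : Fin n → Fin n → ℕ → ℕ
  hanging w u s = if childOf F w u ∧ ⌊ s ℕ.<? k ⌋ then s else 0

  clusterSizeFor : ℕ → Fin n → ℕ
  clusterSizeFor zero    u = 1
  clusterSizeFor (suc t) u = suc (sum (λ w → hanging w u (clusterSizeFor t w)))

  clusterSizeFor-stable : ∀ t t′ u → n ∸ rank u ≤ t → n ∸ rank u ≤ t′ → clusterSizeFor t u ≡ clusterSizeFor t′ u
  clusterSizeFor-stable zero    _        u h _  = contradiction (≤-trans (m<n⇒0<n∸m (rank<n u)) h) λ ()
  clusterSizeFor-stable (suc _) zero     u _ h′ = contradiction (≤-trans (m<n⇒0<n∸m (rank<n u)) h′) λ ()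
  clusterSizeFor-stable (suc t) (suc t′) u h h′ = cong suc (sum-cong-≗ pointwise)
    where
    lower : ∀ {w s} → childOf F w u ≡ true → n ∸ rank u ≤ suc s → n ∸ rank w ≤ s
    lower {w} wu h = ≤-pred (≤-trans (∸-monoʳ-< (parent-rank (childOf-parent F wu)) (<⇒≤ (rank<n w))) h)

    pointwise : ∀ w → hanging w u (clusterSizeFor t w) ≡ hanging w u (clusterSizeFor t′ w)
    pointwise w with childOf F w u in wu
    ... | false = refl
    ... | true  rewrite clusterSizeFor-stable t t′ w (lower wu h) (lower wu h′) = refl

  clusterSize : Fin n → ℕ
  clusterSize = clusterSizeFor n

  light : Fin n → Bool
  light u = ⌊ clusterSize u ℕ.<? k ⌋

  lightChild : Fin n → Fin n → Bool
  lightChild w u = childOf F w u ∧ light w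

  clusterSize-unfold : ∀ u → clusterSize u ≡ suc (sum (λ w → if lightChild w u then clusterSize w else 0))
  clusterSize-unfold u = clusterSizeFor-stable n (suc n) u (m∸n≤m n (rank u)) (m≤n⇒m≤1+n (m∸n≤m n (rank u)))

  light-bound : ∀ {u} → light u ≡ true → clusterSize u ≤ pred k
  light-bound {u} h with clusterSize u ℕ.<? k
  ... | yes lt = <⇒≤pred lt

  heavy-bound : ∀ {u} → light u ≡ false → k ≤ clusterSize u
  heavy-bound {u} h with clusterSize u ℕ.<? k
  ... | no ≮ = ≮⇒≥ ≮

  -- The cluster of u: u and the descendants of u joined to it through light vertices only.
  clusterStep : Fin n → Fin n → Maybe Bool → Bool
  clusterStep u v above = ⌊ v ≟ u ⌋ ∨ (light v ∧ fromMaybe false above)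

  inCluster : Fin n → Fin n → Bool
  inCluster u = Climb.climb F false (clusterStep u)

  inCluster-orphan : ∀ {u v} → parent v ≡ nothing → inCluster u v ≡ ⌊ v ≟ u ⌋
  inCluster-orphan {u} {v} hv
    rewrite Climb.climb-unfold F false (clusterStep u) v | hv | ∧-zeroʳ (light v) = ∨-identityʳ _

  inCluster-child : ∀ {u v p} → parent v ≡ just p → inCluster u v ≡ ⌊ v ≟ u ⌋ ∨ (light v ∧ inCluster u p)
  inCluster-child {u} {v} hv rewrite Climb.climb-unfold F false (clusterStep u) v | hv = refl

  inCluster-self : ∀ u → inCluster u u ≡ true
  inCluster-self u rewrite Climb.climb-unfold F false (clusterStep u) u | ⌊⌋-true (u ≟ u) refl = refl

  inCluster-rank : ∀ {u v} → inCluster u v ≡ true → rank u ≤ rank v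
  inCluster-rank {u} = parent-induction F step _
    where
    step : ∀ v → (∀ {p} → parent v ≡ just p → inCluster u p ≡ true → rank u ≤ rank p) →
           inCluster u v ≡ true → rank u ≤ rank v
    step v ih h with v ≟ u | parent v in hv
    ... | yes refl | _      = ≤-refl
    ... | no v≢u   | nothing rewrite inCluster-orphan {u} hv | ⌊⌋-false (v ≟ u) v≢u = contradiction h λ ()
    ... | no v≢u   | just p rewrite inCluster-child {u} hv | ⌊⌋-false (v ≟ u) v≢u =
          <⇒≤ (≤-<-trans (ih refl (proj₂ (∧-true h))) (parent-rank hv))

  parent-notInCluster : ∀ {v p} → parent v ≡ just p → inCluster v p ≡ false
  parent-notInCluster {v} {p} hv with inCluster v p in h
  ... | false = refl
  ... | true  = contradiction (inCluster-rank h) (<⇒≱ (parent-rank hv))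

  lightChildren-orphan : ∀ {u v} → parent v ≡ nothing → ∀ w → (if lightChild w u then 𝟙 (inCluster w v) else 0) ≡ 0
  lightChildren-orphan {u} {v} hv w rewrite inCluster-orphan {w} hv with v ≟ w
  ... | yes refl rewrite hv = refl
  ... | no _ with lightChild w u
  ...   | true  = refl
  ...   | false = refl

  lightChildren-child : ∀ {u v p} → parent v ≡ just p → ∀ w →
    (if lightChild w u then 𝟙 (inCluster w v) else 0) ≡
    (if ⌊ w ≟ v ⌋ then 𝟙 (lightChild v u) else 0) + 𝟙 (light v) * (if lightChild w u then 𝟙 (inCluster w p) else 0)
  lightChildren-child {u} {v} {p} hv w rewrite inCluster-child {w} hv with w ≟ v
  ... | yes refl rewrite ⌊⌋-true (w ≟ w) refl | parent-notInCluster hv with lightChild w u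
  ...   | true  = sym (cong suc (*-zeroʳ (𝟙 (light w))))
  ...   | false = sym (*-zeroʳ (𝟙 (light w)))
  lightChildren-child {u} {v} {p} hv w | no w≢v rewrite ⌊⌋-false (v ≟ w) (w≢v ∘ sym) with lightChild w u
  ...   | true  = 𝟙-∧ (light v) (inCluster w p)
  ...   | false = sym (*-zeroʳ (𝟙 (light v)))

  inCluster-via-parent : ∀ {u v p} → parent v ≡ just p →
    𝟙 (lightChild v u) + 𝟙 (light v) * 𝟙 (not ⌊ p ≟ u ⌋ ∧ inCluster u p) ≡ 𝟙 (not ⌊ v ≟ u ⌋ ∧ inCluster u v)
  inCluster-via-parent {u} {v} {p} hv rewrite inCluster-child {u} hv | hv with v ≟ u
  ... | yes refl rewrite ⌊⌋-false (p ≟ v) (λ { refl → <-irrefl refl (parent-rank hv) }) | parent-notInCluster hv =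
        *-zeroʳ (𝟙 (light v))
  ... | no _ with p ≟ u
  ...   | yes refl rewrite inCluster-self p with light v
  ...     | true  = refl
  ...     | false = refl
  inCluster-via-parent {u} {v} {p} hv | no _ | no _ = sym (𝟙-∧ (light v) (inCluster u p))

  lightChildClusters : Fin n → Fin n → ℕ
  lightChildClusters u v = sum (λ w → if lightChild w u then 𝟙 (inCluster w v) else 0)

  inCluster-lightChild : ∀ u v → lightChildClusters u v ≡ 𝟙 (not ⌊ v ≟ u ⌋ ∧ inCluster u v)
  inCluster-lightChild u = parent-induction F step
    where
    step : ∀ v → (∀ {p} → parent v ≡ just p → lightChildClusters u p ≡ 𝟙 (not ⌊ p ≟ u ⌋ ∧ inCluster u p)) →
           lightChildClusters u v ≡ 𝟙 (not ⌊ v ≟ u ⌋ ∧ inCluster u v)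
    step v ih with parent v in hv
    ... | nothing rewrite inCluster-orphan {u} hv =
          trans (sum-cong-≗ (lightChildren-orphan hv)) (trans (sum-replicate-zero n) (sym (not-∧-self ⌊ v ≟ u ⌋)))
    ... | just p = begin
      lightChildClusters u v
        ≡⟨ sum-cong-≗ (lightChildren-child hv) ⟩
      sum (λ w → (if ⌊ w ≟ v ⌋ then 𝟙 (lightChild v u) else 0) + 𝟙 (light v) * (if lightChild w u then 𝟙 (inCluster w p) else 0))
        ≡⟨ ∑-distrib-+ {n} _ _ ⟩
      sum (λ w → if ⌊ w ≟ v ⌋ then 𝟙 (lightChild v u) else 0) + sum (λ w → 𝟙 (light v) * (if lightChild w u then 𝟙 (inCluster w p) else 0))
        ≡⟨ cong₂ _+_ (sum-δ (λ _ → 𝟙 (lightChild v u)) v) (sym (*-distribˡ-sum {n} (𝟙 (light v)) _)) ⟩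
      𝟙 (lightChild v u) + 𝟙 (light v) * lightChildClusters u p
        ≡⟨ cong (λ x → 𝟙 (lightChild v u) + 𝟙 (light v) * x) (ih refl) ⟩
      𝟙 (lightChild v u) + 𝟙 (light v) * 𝟙 (not ⌊ p ≟ u ⌋ ∧ inCluster u p)
        ≡⟨ inCluster-via-parent hv ⟩
      𝟙 (not ⌊ v ≟ u ⌋ ∧ inCluster u v) ∎
      where open ≡-Reasoning

  count-inCluster : ∀ u → count (inCluster u) ≡ clusterSize u
  count-inCluster = child-induction F λ u ih → begin
    count (inCluster u)
      ≡⟨ sum-cong-≗ (split u) ⟩
    sum (λ v → (if ⌊ v ≟ u ⌋ then 1 else 0) + 𝟙 (not ⌊ v ≟ u ⌋ ∧ inCluster u v))
      ≡⟨ ∑-distrib-+ {n} _ _ ⟩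
    sum (λ v → if ⌊ v ≟ u ⌋ then 1 else 0) + sum (λ v → 𝟙 (not ⌊ v ≟ u ⌋ ∧ inCluster u v))
      ≡⟨ cong₂ _+_ (sum-δ (λ _ → 1) u) (sym (sum-cong-≗ (inCluster-lightChild u))) ⟩
    suc (sum (lightChildClusters u))
      ≡⟨ cong suc (∑-comm (λ v w → if lightChild w u then 𝟙 (inCluster w v) else 0)) ⟩
    suc (sum (λ w → sum (λ v → if lightChild w u then 𝟙 (inCluster w v) else 0)))
      ≡⟨ cong suc (sum-cong-≗ (λ w → if-sum (lightChild w u))) ⟨
    suc (sum (λ w → if lightChild w u then count (inCluster w) else 0))
      ≡⟨ cong suc (sum-cong-≗ (λ w → children ih w)) ⟩
    suc (sum (λ w → if lightChild w u then clusterSize w else 0))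
      ≡⟨ clusterSize-unfold u ⟨
    clusterSize u ∎
    where
    open ≡-Reasoning
    split : ∀ u v → 𝟙 (inCluster u v) ≡ (if ⌊ v ≟ u ⌋ then 1 else 0) + 𝟙 (not ⌊ v ≟ u ⌋ ∧ inCluster u v)
    split u v with v ≟ u
    ... | yes refl = cong 𝟙 (inCluster-self v)
    ... | no _     = refl
    if-sum : ∀ b {g : Fin n → ℕ} → (if b then sum g else 0) ≡ sum (λ v → if b then g v else 0)
    if-sum true  = refl
    if-sum false = sym (sum-replicate-zero n)
    children : ∀ {u} → (∀ {w} → parent w ≡ just u → count (inCluster w) ≡ clusterSize w) →
               ∀ w → (if lightChild w u then count (inCluster w) else 0) ≡ (if lightChild w u then clusterSize w else 0)
    children {u} ih w with childOf F w u in wu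
    ... | false = refl
    ... | true  rewrite ih (childOf-parent F wu) = refl

  clusterSize≤ : ∀ u → clusterSize u ≤ suc (degree G u * pred k)
  clusterSize≤ u = begin
    clusterSize u                                                  ≡⟨ clusterSize-unfold u ⟩
    suc (sum (λ w → if lightChild w u then clusterSize w else 0))  ≤⟨ s≤s (sum-mono-≤ pointwise) ⟩
    suc (sum (λ w → 𝟙 (adj G u w) * pred k))                      ≡⟨ cong suc (*-distribʳ-sum (pred k) (λ w → 𝟙 (adj G u w))) ⟨
    suc (count (adj G u) * pred k)                                 ≡⟨ cong (λ d → suc (d * pred k)) (Σ≡sum n _) ⟨
    suc (degree G u * pred k)                                      ∎
    where
    open ≤-Reasoning
    pointwise : ∀ w → (if lightChild w u then clusterSize w else 0) ≤ 𝟙 (adj G u w) * pred k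
    pointwise w with childOf F w u in wu | light w in lw
    ... | false | _     = z≤n
    ... | true  | false = z≤n
    ... | true  | true rewrite adj-sym G u w | parent-adj (childOf-parent F wu) =
          ≤-trans (light-bound lw) (≤-reflexive (sym (+-identityʳ (pred k))))

  anchorStep : Fin n → Maybe (Maybe (Fin n)) → Maybe (Fin n)
  anchorStep v above = if light v then fromMaybe nothing above else just v

  -- The first heavy vertex on the path from v to its root, if there is one.
  anchor : Fin n → Maybe (Fin n)
  anchor = Climb.climb F nothing anchorStep

  anchor-heavy : ∀ {v} → light v ≡ false → anchor v ≡ just v
  anchor-heavy {v} lv rewrite Climb.climb-unfold F nothing anchorStep v | lv = refl

  anchor-orphan : ∀ {v} → parent v ≡ nothing → light v ≡ true → anchor v ≡ nothing
  anchor-orphan {v} hv lv rewrite Climb.climb-unfold F nothing anchorStep v | hv | lv = refl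

  anchor-child : ∀ {v p} → parent v ≡ just p → light v ≡ true → anchor v ≡ anchor p
  anchor-child {v} hv lv rewrite Climb.climb-unfold F nothing anchorStep v | hv | lv = refl

  anchor-just : ∀ {c} v → anchor v ≡ just c → light c ≡ false × inCluster c v ≡ true
  anchor-just {c} = parent-induction F step
    where
    step : ∀ v → (∀ {p} → parent v ≡ just p → anchor p ≡ just c → light c ≡ false × inCluster c p ≡ true) →
           anchor v ≡ just c → light c ≡ false × inCluster c v ≡ true
    step v ih h with light v in lv | parent v in hv
    ... | false | _ with refl ← trans (sym (anchor-heavy lv)) h = lv , inCluster-self v
    ... | true  | nothing = contradiction (trans (sym (anchor-orphan hv lv)) h) λ ()
    ... | true  | just p with heavy-c , c∋p ← ih refl (trans (sym (anchor-child hv lv)) h)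
          rewrite inCluster-child {c} hv | lv | c∋p = heavy-c , ∨-zeroʳ _

  just-anchor : ∀ {c} → light c ≡ false → ∀ v → inCluster c v ≡ true → anchor v ≡ just c
  just-anchor {c} heavy-c = parent-induction F step
    where
    step : ∀ v → (∀ {p} → parent v ≡ just p → inCluster c p ≡ true → anchor p ≡ just c) →
           inCluster c v ≡ true → anchor v ≡ just c
    step v ih h with v ≟ c | parent v in hv
    ... | yes refl | _ = anchor-heavy heavy-c
    ... | no v≢c | nothing rewrite inCluster-orphan {c} hv | ⌊⌋-false (v ≟ c) v≢c = contradiction h λ ()
    ... | no v≢c | just p rewrite inCluster-child {c} hv | ⌊⌋-false (v ≟ c) v≢c
          with lv , c∋p ← ∧-true h = trans (anchor-child hv lv) (ih refl c∋p)

  anchor-nothing : ∀ v → anchor v ≡ nothing → light (root v) ≡ true × inCluster (root v) v ≡ true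
  anchor-nothing = parent-induction F step
    where
    step : ∀ v → (∀ {p} → parent v ≡ just p → anchor p ≡ nothing → light (root p) ≡ true × inCluster (root p) p ≡ true) →
           anchor v ≡ nothing → light (root v) ≡ true × inCluster (root v) v ≡ true
    step v ih h with light v in lv | parent v in hv
    ... | false | _ = contradiction (trans (sym h) (anchor-heavy lv)) λ ()
    ... | true  | nothing rewrite orphan-root hv = lv , inCluster-self v
    ... | true  | just p with light-ρ , ρ∋p ← ih refl (trans (sym (anchor-child hv lv)) h)
          rewrite parent-root hv | inCluster-child {root p} hv | lv | ρ∋p = light-ρ , ∨-zeroʳ _

  HangsFromTop : Fin n → Set
  HangsFromTop w = ∃ λ p → parent w ≡ just p × anchor p ≡ nothing

  hangsFromTop? : ∀ w → Dec (HangsFromTop w)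
  hangsFromTop? w with parent w
  ... | nothing = no λ { (_ , () , _) }
  ... | just p with anchor p in ap
  ...   | nothing = yes (p , refl , ap)
  ...   | just _  = no λ { (_ , refl , ap′) → contradiction (trans (sym ap) ap′) λ () }

  -- A heavy vertex of the tree of ρ whose part may absorb the anchorless top of that tree.
  Candidate : Fin n → Fin n → Set
  Candidate ρ w = light w ≡ false × root w ≡ ρ × HangsFromTop w

  candidate? : ∀ ρ w → Dec (Candidate ρ w)
  candidate? ρ w = (light w Bool.≟ false) ×-dec (root w ≟ ρ) ×-dec hangsFromTop? w

  host : Fin n → Fin n
  host ρ with Fin.any? (candidate? ρ)
  ... | yes (w , _) = w
  ... | no _        = ρ

  host-spec : ∀ ρ → Candidate ρ (host ρ) ⊎ ((∀ w → ¬ Candidate ρ w) × host ρ ≡ ρ)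
  host-spec ρ with Fin.any? (candidate? ρ)
  ... | yes (_ , candidate) = inj₁ candidate
  ... | no none             = inj₂ ((λ w c → none (w , c)) , refl)

  root-host : ∀ v → root (host (root v)) ≡ root v
  root-host v with host-spec (root v)
  ... | inj₁ (_ , root-w , _) = root-w
  ... | inj₂ (_ , host≡)      = trans (cong root host≡) (proj₂ (root-is-root F v))

  root-host-orphan : ∀ {ρ} → parent ρ ≡ nothing → root (host ρ) ≡ ρ
  root-host-orphan {ρ} hρ = trans (cong (root ∘ host) (sym (orphan-root hρ))) (trans (root-host ρ) (orphan-root hρ))

  part : Partition G
  part v = fromMaybe (host (root v)) (anchor v)

  part-heavy : ∀ {v} → light v ≡ false → part v ≡ v
  part-heavy lv rewrite anchor-heavy lv = refl

  part-light-child : ∀ {v p} → parent v ≡ just p → light v ≡ true → part v ≡ part p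
  part-light-child hv lv rewrite anchor-child hv lv | parent-root hv = refl

  host-parent : ∀ {w p} → parent w ≡ just p → host (root w) ≡ w → part p ≡ w
  host-parent {w} {p} hw host≡w with host-spec (root w)
  ... | inj₂ (_ , host≡root) =
        contradiction (trans (sym (proj₁ (root-is-root F w))) (trans (cong parent (trans (sym host≡root) host≡w)) hw)) λ ()
  ... | inj₁ candidate with _ , _ , _ , hw′ , anchorless ← subst (Candidate (root w)) host≡w candidate
                       with refl ← trans (sym hw′) hw
    = trans (cong (fromMaybe (host (root p))) anchorless) (trans (cong host (sym (parent-root hw))) host≡w)

  -- The unique vertex of a part whose parent lies outside it.
  entry : Fin n → Fin n
  entry c = if ⌊ host (root c) ≟ c ⌋ then root c else c

  entry-root : ∀ {c} → root c ≡ c → entry c ≡ c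
  entry-root {c} rc rewrite rc with ⌊ host c ≟ c ⌋
  ... | true  = refl
  ... | false = refl

  entry-host : ∀ {ρ} → parent ρ ≡ nothing → entry (host ρ) ≡ ρ
  entry-host {ρ} hρ rewrite root-host-orphan hρ | ⌊⌋-true (host ρ ≟ host ρ) refl = refl

  parentInPart⊎entry : ∀ i → parentInPart F part i ≡ true ⊎ i ≡ entry (part i)
  parentInPart⊎entry i with parent i in hi | light i in li
  ... | just p  | true  rewrite part-light-child hi li = inj₁ (⌊⌋-true (part p ≟ part p) refl)
  ... | nothing | true  rewrite anchor-orphan hi li | orphan-root hi = inj₂ (sym (entry-host hi))
  ... | nothing | false rewrite part-heavy li = inj₂ (sym (entry-root (orphan-root hi)))
  ... | just p  | false rewrite part-heavy li with host (root i) ≟ i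
  ...   | yes host≡i = inj₁ (⌊⌋-true (part p ≟ i) (host-parent hi host≡i))
  ...   | no _ = inj₂ refl

  part-anchored : ∀ {v c} → anchor v ≡ just c → part v ≡ c
  part-anchored {v} = cong (fromMaybe (host (root v)))

  part-anchorless : ∀ {v} → anchor v ≡ nothing → part v ≡ host (root v)
  part-anchorless {v} = cong (fromMaybe (host (root v)))

  tree-anchorless : ∀ {ρ} → (∀ w → ¬ Candidate ρ w) → light ρ ≡ true → ∀ j → root j ≡ ρ → anchor j ≡ nothing
  tree-anchorless {ρ} none light-ρ = parent-induction F step
    where
    step : ∀ j → (∀ {p} → parent j ≡ just p → root p ≡ ρ → anchor p ≡ nothing) → root j ≡ ρ → anchor j ≡ nothing
    step j ih rj with parent j in hj
    ... | nothing = anchor-orphan hj (trans (cong light (trans (sym (orphan-root hj)) rj)) light-ρ)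
    ... | just p with light j in lj
    ...   | true  = trans (anchor-child hj lj) (ih refl (trans (sym (parent-root hj)) rj))
    ...   | false = contradiction (lj , rj , p , hj , ih refl (trans (sym (parent-root hj)) rj)) (none j)

  light-part-closed : ∀ {i j} → light (part i) ≡ true → adj G i j ≡ true → part j ≡ part i
  light-part-closed {i} {j} light-part i~j = by-anchor (anchor i) refl
    where
    by-anchor : ∀ a → anchor i ≡ a → part j ≡ part i
    by-anchor (just c) ai =
      contradiction (trans (sym light-part) (trans (cong light (part-anchored {i} ai)) (proj₁ (anchor-just i ai)))) λ ()
    by-anchor nothing ai with host-spec (root i)
    ... | inj₁ (heavy , _) =
          contradiction (trans (sym light-part) (trans (cong light (part-anchorless {i} ai)) heavy)) λ ()
    ... | inj₂ (none , host≡root) = begin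
      part j         ≡⟨ part-anchorless {j} (tree-anchorless none light-root j (sym (adj-root i~j))) ⟩
      host (root j)  ≡⟨ cong host (adj-root i~j) ⟨
      host (root i)  ≡⟨ part-anchorless {i} ai ⟨
      part i         ∎
      where
      open ≡-Reasoning
      light-root : light (root i) ≡ true
      light-root = trans (cong light (sym (trans (part-anchorless {i} ai) host≡root))) light-part

  size : Fin n → ℕ
  size = partSize G part

  in-part : ∀ c i → 𝟙 ⌊ part i ≟ c ⌋ ≤ 𝟙 (not (light c) ∧ inCluster c i) + 𝟙 (light (root c) ∧ inCluster (root c) i)
  in-part c i with part i ≟ c
  ... | no _     = z≤n
  ... | yes refl = by-anchor (anchor i) refl
    where
    by-anchor : ∀ a → anchor i ≡ a →
                1 ≤ 𝟙 (not (light (part i)) ∧ inCluster (part i) i) + 𝟙 (light (root (part i)) ∧ inCluster (root (part i)) i)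
    by-anchor (just c) ai rewrite part-anchored {i} ai | proj₁ (anchor-just i ai) | proj₂ (anchor-just i ai) = s≤s z≤n
    by-anchor nothing ai rewrite part-anchorless {i} ai | root-host i | proj₁ (anchor-nothing i ai) | proj₂ (anchor-nothing i ai) =
      m≤n+m 1 _

  size≤ : ∀ {Δ} → (∀ u → degree G u ≤ Δ) → ∀ c → size c ≤ partBound Δ k
  size≤ {Δ} degree≤ c = begin
    size c
      ≤⟨ sum-mono-≤ (in-part c) ⟩
    sum (λ i → 𝟙 (not (light c) ∧ inCluster c i) + 𝟙 (light (root c) ∧ inCluster (root c) i))
      ≡⟨ ∑-distrib-+ {n} _ _ ⟩
    count (λ i → not (light c) ∧ inCluster c i) + count (λ i → light (root c) ∧ inCluster (root c) i)
      ≡⟨ cong₂ _+_ (count-∧ _ (inCluster c)) (count-∧ _ (inCluster (root c))) ⟩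
    𝟙 (not (light c)) * count (inCluster c) + 𝟙 (light (root c)) * count (inCluster (root c))
      ≡⟨ cong₂ _+_ (cong (𝟙 (not (light c)) *_) (count-inCluster c)) (cong (𝟙 (light (root c)) *_) (count-inCluster (root c))) ⟩
    𝟙 (not (light c)) * clusterSize c + 𝟙 (light (root c)) * clusterSize (root c)
      ≤⟨ +-mono-≤ (heavy-term (light c)) (light-term (light (root c)) refl) ⟩
    partBound Δ k ∎
    where
    open ≤-Reasoning
    heavy-term : ∀ b → 𝟙 (not b) * clusterSize c ≤ suc (Δ * pred k)
    heavy-term true  = z≤n
    heavy-term false = ≤-trans (≤-reflexive (+-identityʳ _))
                         (≤-trans (clusterSize≤ c) (s≤s (*-monoˡ-≤ (pred k) (degree≤ c))))
    light-term : ∀ b → light (root c) ≡ b → 𝟙 b * clusterSize (root c) ≤ pred k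
    light-term true  lρ = ≤-trans (≤-reflexive (+-identityʳ _)) (light-bound lρ)
    light-term false _  = z≤n

  k≤size : ∀ {c} → light c ≡ false → k ≤ size c
  k≤size {c} heavy = begin
    k                    ≤⟨ heavy-bound heavy ⟩
    clusterSize c        ≡⟨ count-inCluster c ⟨
    count (inCluster c)  ≤⟨ sum-mono-≤ pointwise ⟩
    size c               ∎
    where
    open ≤-Reasoning
    pointwise : ∀ i → 𝟙 (inCluster c i) ≤ 𝟙 ⌊ part i ≟ c ⌋
    pointwise i with inCluster c i in c∋i
    ... | false = z≤n
    ... | true rewrite ⌊⌋-true (part i ≟ c) (part-anchored {i} (just-anchor heavy i c∋i)) = ≤-refl

  size≤treeEdgesIn : ∀ c → size c ≤ treeEdgesIn F part c + 1
  size≤treeEdgesIn c = begin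
    size c
      ≤⟨ sum-mono-≤ pointwise ⟩
    sum (λ i → 𝟙 (⌊ part i ≟ c ⌋ ∧ parentInPart F part i) + (if ⌊ i ≟ entry c ⌋ then 1 else 0))
      ≡⟨ ∑-distrib-+ {n} _ _ ⟩
    treeEdgesIn F part c + sum (λ i → if ⌊ i ≟ entry c ⌋ then 1 else 0)
      ≡⟨ cong (treeEdgesIn F part c +_) (sum-δ (λ _ → 1) (entry c)) ⟩
    treeEdgesIn F part c + 1 ∎
    where
    open ≤-Reasoning
    pointwise : ∀ i → 𝟙 ⌊ part i ≟ c ⌋ ≤
                      𝟙 (⌊ part i ≟ c ⌋ ∧ parentInPart F part i) + (if ⌊ i ≟ entry c ⌋ then 1 else 0)
    pointwise i with part i ≟ c
    ... | no _     = z≤n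
    ... | yes refl with parentInPart⊎entry i
    ...   | inj₁ inside rewrite inside = s≤s z≤n
    ...   | inj₂ is-entry rewrite ⌊⌋-true (i ≟ entry (part i)) is-entry = m≤n+m 1 _

  heavyCount : ℕ
  heavyCount = count (λ c → not (light c))

  heavyCount*k≤n : heavyCount * k ≤ n
  heavyCount*k≤n = begin
    heavyCount * k                         ≡⟨ *-distribʳ-sum k (λ c → 𝟙 (not (light c))) ⟩
    sum (λ c → 𝟙 (not (light c)) * k)      ≤⟨ sum-mono-≤ pointwise ⟩
    sum size                               ≡⟨ sum-partSize G part ⟩
    n                                      ∎
    where
    open ≤-Reasoning
    pointwise : ∀ c → 𝟙 (not (light c)) * k ≤ size c
    pointwise c with light c in lc
    ... | true  = z≤n
    ... | false = ≤-trans (≤-reflexive (+-identityʳ k)) (k≤size lc)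

  sum-size²≤ : ∀ {Δ} → (∀ u → degree G u ≤ Δ) → sum (λ c → size c * size c) ≤ partBound Δ k * n
  sum-size²≤ {Δ} degree≤ = begin
    sum (λ c → size c * size c)  ≤⟨ sum-mono-≤ (λ c → *-monoˡ-≤ (size c) (size≤ degree≤ c)) ⟩
    sum (λ c → K * size c)       ≡⟨ *-distribˡ-sum K size ⟨
    K * sum size                 ≡⟨ cong (K *_) (sum-partSize G part) ⟩
    K * n                        ∎
    where
    open ≤-Reasoning
    K = partBound Δ k

  module _ {r} (regular : Regular r G) (2≤r : 2 ≤ r) where

    size≤eIn : ∀ c → size c ≤ eIn G part c + 𝟙 (not (light c))
    size≤eIn c with light c in lc
    ... | false = ≤-trans (size≤treeEdgesIn c) (+-monoˡ-≤ 1 (treeEdgesIn≤eIn F part c))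
    ... | true  = *-cancelˡ-≤ 2 (begin
      2 * size c               ≡⟨ *-comm 2 (size c) ⟩
      size c * 2               ≤⟨ *-monoʳ-≤ (size c) 2≤r ⟩
      size c * r               ≤⟨ closed-part G part regular c closed ⟩
      2 * eIn G part c         ≡⟨ cong (2 *_) (+-identityʳ (eIn G part c)) ⟨
      2 * (eIn G part c + 0)   ∎)
      where
      open ≤-Reasoning
      closed : ∀ {i j} → part i ≡ c → adj G i j ≡ true → part j ≡ c
      closed pi≡c i~j = trans (light-part-closed (trans (cong light pi≡c) lc) i~j) pi≡c

    n≤edgesIn+heavyCount : n ≤ Σ[ n ] (eIn G part) + heavyCount
    n≤edgesIn+heavyCount = begin
      n                                                  ≡⟨ sum-partSize G part ⟨
      sum size                                           ≤⟨ sum-mono-≤ size≤eIn ⟩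
      sum (λ c → eIn G part c + 𝟙 (not (light c)))       ≡⟨ ∑-distrib-+ {n} _ _ ⟩
      sum (eIn G part) + heavyCount                      ≡⟨ cong (_+ heavyCount) (Σ≡sum n _) ⟨
      Σ[ n ] (eIn G part) + heavyCount                   ∎
      where open ≤-Reasoning

-- The arithmetic of the bound

-- gap r n k / (r k n) = 2 / (r k) + partBound r k / n bounds 2/r − q.
gap : ℕ → ℕ → ℕ → ℕ
gap r n k = 2 * n + r * partBound r k * k

cleared-gap-bound : ∀ {n k r E D Q K} → n ≤ E + D → D * k ≤ n → Q ≤ K * n →
                    k * (2 * n * n + r * Q) ≤ n * (2 * E * k + (2 * n + r * K * k))
cleared-gap-bound {n} {k} {r} {E} {D} {Q} {K} n≤E+D Dk≤n Q≤Kn = begin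
  k * (2 * n * n + r * Q)                   ≡⟨ solve (n ∷ k ∷ r ∷ Q ∷ []) ⟩
  2 * n * (n * k) + r * k * Q               ≤⟨ +-mono-≤ (*-monoʳ-≤ (2 * n) nk≤Ek+n) (*-monoʳ-≤ (r * k) Q≤Kn) ⟩
  2 * n * (E * k + n) + r * k * (K * n)     ≡⟨ solve (n ∷ k ∷ r ∷ E ∷ K ∷ []) ⟩
  n * (2 * E * k + (2 * n + r * K * k))     ∎
  where
  open ≤-Reasoning
  nk≤Ek+n : n * k ≤ E * k + n
  nk≤Ek+n = ≤-trans (*-monoˡ-≤ k n≤E+D) (≤-trans (≤-reflexive (*-distribʳ-+ k E D)) (+-monoʳ-≤ (E * k) Dk≤n))

-- 2/r + V/(4m²) ≤ E/m + (2n + rKk)/(rkn), cleared of denominators; 2m = nr and V = r²Q.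
gap-bound : ∀ {n k r m E D Q V K} → 2 * m ≡ n * r → V ≡ r * r * Q → n ≤ E + D → D * k ≤ n → Q ≤ K * n →
            (2 * (4 * m * m) + V * r) * (m * (r * k * n)) ≤ (E * (r * k * n) + (2 * n + r * K * k) * m) * (r * (4 * m * m))
gap-bound {n} {k} {r} {m} {E} {D} {Q} {_} {K} 2m≡nr refl n≤E+D Dk≤n Q≤Kn = *-cancelˡ-≤ 2 (begin
  2 * ((2 * (4 * m * m) + r * r * Q * r) * (m * (r * k * n)))
    ≡⟨ solve (m ∷ r ∷ Q ∷ k ∷ n ∷ []) ⟩
  (2 * ((2 * m) * (2 * m)) + r * r * Q * r) * ((2 * m) * (r * k * n))
    ≡⟨ cong (λ t → (2 * (t * t) + r * r * Q * r) * (t * (r * k * n))) 2m≡nr ⟩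
  (2 * ((n * r) * (n * r)) + r * r * Q * r) * ((n * r) * (r * k * n))
    ≡⟨ solve (n ∷ r ∷ Q ∷ k ∷ []) ⟩
  (r * r * r * r * n * n) * (k * (2 * n * n + r * Q))
    ≤⟨ *-monoʳ-≤ (r * r * r * r * n * n) (cleared-gap-bound {n} {k} {r} {E} {D} {Q} {K} n≤E+D Dk≤n Q≤Kn) ⟩
  (r * r * r * r * n * n) * (n * (2 * E * k + (2 * n + r * K * k)))
    ≡⟨ solve (n ∷ r ∷ E ∷ k ∷ K ∷ []) ⟩
  (2 * E * (r * k * n) + (2 * n + r * K * k) * (n * r)) * (r * ((n * r) * (n * r)))
    ≡⟨ cong (λ t → (2 * E * (r * k * n) + (2 * n + r * K * k) * t) * (r * (t * t))) 2m≡nr ⟨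
  (2 * E * (r * k * n) + (2 * n + r * K * k) * (2 * m)) * (r * ((2 * m) * (2 * m)))
    ≡⟨ solve (n ∷ r ∷ E ∷ k ∷ K ∷ m ∷ []) ⟩
  2 * ((E * (r * k * n) + (2 * n + r * K * k) * m) * (r * (4 * m * m))) ∎)
  where open ≤-Reasoning

partBound≤ : ∀ r {k} → 1 ≤ k → partBound r k ≤ suc r * k
partBound≤ r {suc k} _ = ≤-trans (m≤m+n (partBound r (suc k)) r) (≤-reflexive (eq r k))
  where
  eq : ∀ r k → suc (r * k) + k + r ≡ suc r * suc k
  eq = solve-∀

square-+≤ : ∀ {u A} → A ≤ u → u ≤ 4 * A → (u + A) * (u + A) ≤ 8 * u * A
square-+≤ {u} {A} A≤u u≤4A = subst (λ u → (u + A) * (u + A) ≤ 8 * u * A) (m+[n∸m]≡n A≤u) (shifted A (u ∸ A) s≤3A)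
  where
  s≤3A : u ∸ A ≤ 3 * A
  s≤3A = +-cancelˡ-≤ A (u ∸ A) (3 * A) (≤-trans (≤-reflexive (m+[n∸m]≡n A≤u)) (≤-trans u≤4A (≤-reflexive (solve (A ∷ [])))))
  shifted : ∀ A s → s ≤ 3 * A → (A + s + A) * (A + s + A) ≤ 8 * (A + s) * A
  shifted A s s≤3A = begin
    (A + s + A) * (A + s + A)                                ≡⟨ solve (A ∷ s ∷ []) ⟩
    4 * A * A + 4 * A * s + s * s                            ≤⟨ +-monoʳ-≤ (4 * A * A + 4 * A * s) (*-monoˡ-≤ s s≤3A) ⟩
    4 * A * A + 4 * A * s + 3 * A * s                        ≤⟨ m≤m+n _ (4 * A * A + A * s) ⟩
    4 * A * A + 4 * A * s + 3 * A * s + (4 * A * A + A * s)  ≡⟨ solve (A ∷ s ∷ []) ⟩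
    8 * (A + s) * A                                          ∎
    where open ≤-Reasoning

crossing : (P : ℕ → Set) → (∀ j → Dec (P j)) → P 1 → ∀ j → ¬ P (suc j) → ∃ λ k → P (suc k) × ¬ P (suc (suc k))
crossing P P? p₁ zero    ¬p = contradiction p₁ ¬p
crossing P P? p₁ (suc j) ¬p with P? (suc j)
... | yes p  = j , p , ¬p
... | no ¬p′ = crossing P P? p₁ j ¬p′

gap-small-n : ∀ {r n} → 2 ≤ r → r < n → 2 * n < r * suc r → gap r n 1 * gap r n 1 * n ≤ 24 * ((r * 1 * n) * (r * 1 * n))
gap-small-n {r} {n} 2≤r r<n 2n<r[r+1] = begin
  gap r n 1 * gap r n 1 * n        ≡⟨ cong (λ g → g * g * n) (cong (2 * n +_) rK≡r) ⟩
  (2 * n + r) * (2 * n + r) * n    ≤⟨ *-monoˡ-≤ n (*-mono-≤ 2n+r≤3n 2n+r≤3n) ⟩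
  (2 * n + n) * (2 * n + n) * n    ≡⟨ solve (n ∷ []) ⟩
  9 * n * (n * n)                  ≤⟨ *-monoˡ-≤ (n * n) (*-mono-≤ (≤-refl {9}) (<⇒≤ n<r²)) ⟩
  9 * (r * r) * (n * n)            ≤⟨ *-monoˡ-≤ (n * n) (*-monoˡ-≤ (r * r) {9} {24} (+-monoʳ-≤ 9 z≤n)) ⟩
  24 * (r * r) * (n * n)           ≡⟨ solve (r ∷ n ∷ []) ⟩
  24 * ((r * 1 * n) * (r * 1 * n)) ∎
  where
  open ≤-Reasoning
  rK≡r : r * (suc (r * 0) + 0) * 1 ≡ r
  rK≡r = solve (r ∷ [])
  2n+r≤3n : 2 * n + r ≤ 2 * n + n
  2n+r≤3n = +-monoʳ-≤ (2 * n) (<⇒≤ r<n)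
  n<r² : n < r * r
  n<r² = *-cancelˡ-< 2 n (r * r) (<-≤-trans 2n<r[r+1] (begin
    r * suc r      ≡⟨ solve (r ∷ []) ⟩
    r * r + r * 1  ≤⟨ +-monoʳ-≤ (r * r) (*-monoʳ-≤ r (≤-trans (s≤s z≤n) 2≤r)) ⟩
    r * r + r * r  ≡⟨ solve (r ∷ []) ⟩
    2 * (r * r)    ∎))

[1+k]²≤4k² : ∀ {k} → 1 ≤ k → suc k * suc k ≤ 4 * (k * k)
[1+k]²≤4k² {suc j} _ = begin
  suc (suc j) * suc (suc j)                          ≤⟨ m≤m+n _ (3 * (j * j) + 4 * j) ⟩
  suc (suc j) * suc (suc j) + (3 * (j * j) + 4 * j)  ≡⟨ solve (j ∷ []) ⟩
  4 * (suc j * suc j)                                ∎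
  where open ≤-Reasoning

gap-large-n : ∀ {r n k} → 2 ≤ r → 1 ≤ k → r * suc r * (k * k) ≤ 2 * n → 2 * n < r * suc r * (suc k * suc k) →
              gap r n k * gap r n k * n ≤ 24 * ((r * k * n) * (r * k * n))
gap-large-n {r} {n} {k} 2≤r 1≤k A≤2n 2n<A′ = begin
  gap r n k * gap r n k * n                                           ≤⟨ *-monoˡ-≤ n (*-mono-≤ gap≤ gap≤) ⟩
  (2 * n + r * suc r * (k * k)) * (2 * n + r * suc r * (k * k)) * n   ≤⟨ *-monoˡ-≤ n (square-+≤ A≤2n 2n≤4A) ⟩
  8 * (2 * n) * (r * suc r * (k * k)) * n                             ≡⟨ solve (n ∷ r ∷ k ∷ []) ⟩
  16 * (r * suc r) * (k * k * (n * n))                                ≤⟨ *-monoˡ-≤ (k * k * (n * n)) 16r[r+1]≤24r² ⟩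
  24 * (r * r) * (k * k * (n * n))                                    ≡⟨ solve (r ∷ k ∷ n ∷ []) ⟩
  24 * ((r * k * n) * (r * k * n))                                    ∎
  where
  open ≤-Reasoning
  gap≤ : gap r n k ≤ 2 * n + r * suc r * (k * k)
  gap≤ = +-monoʳ-≤ (2 * n) (begin
    r * partBound r k * k  ≤⟨ *-monoˡ-≤ k (*-monoʳ-≤ r (partBound≤ r 1≤k)) ⟩
    r * (suc r * k) * k    ≡⟨ solve (r ∷ k ∷ []) ⟩
    r * suc r * (k * k)    ∎)
  2n≤4A : 2 * n ≤ 4 * (r * suc r * (k * k))
  2n≤4A = <⇒≤ (begin-strict
    2 * n                          <⟨ 2n<A′ ⟩
    r * suc r * (suc k * suc k)    ≤⟨ *-monoʳ-≤ (r * suc r) ([1+k]²≤4k² 1≤k) ⟩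
    r * suc r * (4 * (k * k))      ≡⟨ solve (r ∷ k ∷ []) ⟩
    4 * (r * suc r * (k * k))      ∎)
  16r[r+1]≤24r² : 16 * (r * suc r) ≤ 24 * (r * r)
  16r[r+1]≤24r² = begin
    16 * (r * suc r)          ≡⟨ solve (r ∷ []) ⟩
    16 * (r * r) + 8 * r * 2  ≤⟨ +-monoʳ-≤ (16 * (r * r)) (*-monoʳ-≤ (8 * r) 2≤r) ⟩
    16 * (r * r) + 8 * r * r  ≡⟨ solve (r ∷ []) ⟩
    24 * (r * r)              ∎

choose-k : ∀ {r n} → 2 ≤ r → r < n →
           ∃ λ k → gap r n (suc k) * gap r n (suc k) * n ≤ 24 * ((r * suc k * n) * (r * suc k * n))
choose-k {r} {n} 2≤r r<n with r * suc r * (1 * 1) ℕ.≤? 2 * n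
... | no ¬A₁≤2n = 0 , gap-small-n 2≤r r<n (<-≤-trans (≰⇒> ¬A₁≤2n) (≤-reflexive (*-identityʳ _)))
... | yes A₁≤2n =
  let k , Aₖ≤2n , ¬Aₖ₊₁≤2n = crossing (λ j → r * suc r * (j * j) ≤ 2 * n) (λ j → _ ℕ.≤? _) A₁≤2n n ¬Aₙ₊₁≤2n
  in k , gap-large-n 2≤r (s≤s z≤n) Aₖ≤2n (≰⇒> ¬Aₖ₊₁≤2n)
  where
  ¬Aₙ₊₁≤2n : ¬ (r * suc r * (suc n * suc n) ≤ 2 * n)
  ¬Aₙ₊₁≤2n A≤2n = <-irrefl refl (<-≤-trans (begin-strict
    2 * n                           <⟨ s≤s (m≤m+n (2 * n) (n * n)) ⟩
    suc (2 * n + n * n)             ≡⟨ solve (n ∷ []) ⟩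
    1 * (suc n * suc n)             ≤⟨ *-monoˡ-≤ (suc n * suc n) 1≤r[r+1] ⟩
    r * suc r * (suc n * suc n)     ∎) A≤2n)
    where
    open ≤-Reasoning
    1≤r[r+1] : 1 ≤ r * suc r
    1≤r[r+1] = *-mono-≤ (≤-trans (s≤s z≤n) 2≤r) (s≤s z≤n)

-- Rational arithmetic

toℚᵘ-/ : ∀ a b → toℚᵘ ((ℤ.+ a) / suc b) ≃ᵘ mkℚᵘ (ℤ.+ a) b
toℚᵘ-/ a b = toℚᵘ-fromℚᵘ (mkℚᵘ (ℤ.+ a) b)

/-mono-≤ : ∀ a b c d .{{_ : ℕ.NonZero b}} .{{_ : ℕ.NonZero d}} → a * d ≤ c * b → (ℤ.+ a) / b ℚ.≤ (ℤ.+ c) / d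
/-mono-≤ a (suc b) c (suc d) ad≤cb =
  toℚᵘ-cancel-≤ (ℚᵘ.≤-respˡ-≃ (ℚᵘ.≃-sym (toℚᵘ-/ a b)) (ℚᵘ.≤-respʳ-≃ (ℚᵘ.≃-sym (toℚᵘ-/ c d))
    (*≤* (subst₂ ℤ._≤_ (ℤ.pos-* a (suc d)) (ℤ.pos-* c (suc b)) (ℤ.+≤+ ad≤cb)))))

/-+ : ∀ a b c d .{{_ : ℕ.NonZero b}} .{{_ : ℕ.NonZero d}} →
      (ℤ.+ a) / b ℚ.+ (ℤ.+ c) / d ≡ ((ℤ.+ (a * d + c * b)) / (b * d)) {{m*n≢0 b d}}
/-+ a (suc b) c (suc d) = toℚᵘ-injective (begin
  toℚᵘ ((ℤ.+ a) / suc b ℚ.+ (ℤ.+ c) / suc d)              ≈⟨ toℚᵘ-homo-+ ((ℤ.+ a) / suc b) ((ℤ.+ c) / suc d) ⟩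
  toℚᵘ ((ℤ.+ a) / suc b) ℚᵘ.+ toℚᵘ ((ℤ.+ c) / suc d)      ≈⟨ ℚᵘ.+-cong (toℚᵘ-/ a b) (toℚᵘ-/ c d) ⟩
  mkℚᵘ (ℤ.+ a) b ℚᵘ.+ mkℚᵘ (ℤ.+ c) d                      ≡⟨ cong (λ z → mkℚᵘ z (pred (suc b * suc d))) numerator ⟩
  mkℚᵘ (ℤ.+ (a * suc d + c * suc b)) (pred (suc b * suc d)) ≈⟨ toℚᵘ-/ _ _ ⟨
  toℚᵘ ((ℤ.+ (a * suc d + c * suc b)) / (suc b * suc d)) ∎)
  where
  open ℚᵘ.≃-Reasoning
  numerator : (ℤ.+ a) ℤ.* (ℤ.+ suc d) ℤ.+ (ℤ.+ c) ℤ.* (ℤ.+ suc b) ≡ ℤ.+ (a * suc d + c * suc b)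
  numerator = sym (trans (ℤ.pos-+ (a * suc d) (c * suc b)) (cong₂ ℤ._+_ (ℤ.pos-* a (suc d)) (ℤ.pos-* c (suc b))))

/-* : ∀ a b c d .{{_ : ℕ.NonZero b}} .{{_ : ℕ.NonZero d}} →
      ((ℤ.+ a) / b) ℚ.* ((ℤ.+ c) / d) ≡ ((ℤ.+ (a * c)) / (b * d)) {{m*n≢0 b d}}
/-* a (suc b) c (suc d) = toℚᵘ-injective (begin
  toℚᵘ (((ℤ.+ a) / suc b) ℚ.* ((ℤ.+ c) / suc d))          ≈⟨ toℚᵘ-homo-* ((ℤ.+ a) / suc b) ((ℤ.+ c) / suc d) ⟩
  toℚᵘ ((ℤ.+ a) / suc b) ℚᵘ.* toℚᵘ ((ℤ.+ c) / suc d)      ≈⟨ ℚᵘ.*-cong (toℚᵘ-/ a b) (toℚᵘ-/ c d) ⟩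
  mkℚᵘ (ℤ.+ a) b ℚᵘ.* mkℚᵘ (ℤ.+ c) d                      ≡⟨ cong (λ z → mkℚᵘ z (pred (suc b * suc d))) (sym (ℤ.pos-* a c)) ⟩
  mkℚᵘ (ℤ.+ (a * c)) (pred (suc b * suc d))             ≈⟨ toℚᵘ-/ _ _ ⟨
  toℚᵘ ((ℤ.+ (a * c)) / (suc b * suc d))                ∎)
  where open ℚᵘ.≃-Reasoning

deficit≤ : ∀ {a b c q z : ℚ} → b ℚ.- c ℚ.≤ q → a ℚ.+ c ℚ.≤ b ℚ.+ z → a ℚ.- q ℚ.≤ z
deficit≤ {a} {b} {c} {q} {z} b-c≤q a+c≤b+z = begin
  a ℚ.- q          ≤⟨ ℚ.+-monoʳ-≤ a (ℚ.neg-antimono-≤ b-c≤q) ⟩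
  a ℚ.- (b ℚ.- c)  ≡⟨ ℚ-solve 3 (λ a b c → a :- (b :- c) := (a :+ c) :- b) refl a b c ⟩
  a ℚ.+ c ℚ.- b    ≤⟨ ℚ.+-monoˡ-≤ (ℚ.- b) a+c≤b+z ⟩
  b ℚ.+ z ℚ.- b    ≡⟨ ℚ-solve 2 (λ b z → b :+ z :- b := z) refl b z ⟩
  z                ∎
  where
  open ℚ.≤-Reasoning
  open ℚ-Solver using (_:=_; _:+_; _:-_) renaming (solve to ℚ-solve)

square≤ : ∀ {x z t : ℚ} → 0ℚ ℚ.≤ z → x ℚ.≤ z → z ℚ.* z ℚ.≤ t → x ℚ.≤ 0ℚ ⊎ x ℚ.* x ℚ.≤ t
square≤ {x} {z} {t} 0≤z x≤z z²≤t with x ℚ.≤? 0ℚ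
... | yes x≤0 = inj₁ x≤0
... | no  x≰0 = inj₂ (begin
  x ℚ.* x  ≤⟨ ℚ.*-monoˡ-≤-nonNeg x x≤z ⟩
  x ℚ.* z  ≤⟨ ℚ.*-monoʳ-≤-nonNeg z x≤z ⟩
  z ℚ.* z  ≤⟨ z²≤t ⟩
  t        ∎)
  where
  open ℚ.≤-Reasoning
  instance
    x-nonNeg : ℚ.NonNegative x
    x-nonNeg = ℚ.nonNegative (ℚ.<⇒≤ (ℚ.≰⇒> x≰0))
    z-nonNeg : ℚ.NonNegative z
    z-nonNeg = ℚ.nonNegative 0≤z

square-/≤ : ∀ a b c d .{{_ : ℕ.NonZero b}} .{{_ : ℕ.NonZero d}} → a * a * d ≤ c * (b * b) →
            ((ℤ.+ a) / b) ℚ.* ((ℤ.+ a) / b) ℚ.≤ (ℤ.+ c) / d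
square-/≤ a b c d h = subst (ℚ._≤ (ℤ.+ c) / d) (sym (/-* a b a b)) (/-mono-≤ (a * a) (b * b) c d {{m*n≢0 b b}} h)

qPart≡ : ∀ {n m} (G : Graph n) f → edges G ≡ suc m →
         qPart G f ≡ (ℤ.+ Σ[ n ] (eIn G f)) / suc m ℚ.- (ℤ.+ Σ[ n ] (λ c → vol G f c * vol G f c)) / (4 * suc m * suc m)
qPart≡ G f edges≡ rewrite edges≡ = refl

deficit≤gap : ∀ {n r m} (G : Graph (suc n)) → Regular (suc r) G → 2 ≤ suc r → edges G ≡ suc m →
              ∀ k q → (∀ f → qPart G f ℚ.≤ q) →
              (ℤ.+ 2) / suc r ℚ.- q ℚ.≤ (ℤ.+ gap (suc r) (suc n) (suc k)) / (suc r * suc k * suc n)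
deficit≤gap {n} {r} {m} G regular 2≤r edges≡ k q q-max =
  deficit≤ {(ℤ.+ 2) / suc r} {(ℤ.+ E) / suc m} {(ℤ.+ V) / (4 * suc m * suc m)} {q} {(ℤ.+ Z) / (suc r * suc k * suc n)}
    (subst (ℚ._≤ q) (qPart≡ G part edges≡) (q-max part)) (begin
    (ℤ.+ 2) / suc r ℚ.+ (ℤ.+ V) / (4 * suc m * suc m)          ≡⟨ /-+ 2 (suc r) V (4 * suc m * suc m) ⟩
    (ℤ.+ (2 * (4 * suc m * suc m) + V * suc r)) / (suc r * (4 * suc m * suc m))
      ≤⟨ /-mono-≤ (2 * (4 * suc m * suc m) + V * suc r) (suc r * (4 * suc m * suc m))
                  (E * (suc r * suc k * suc n) + Z * suc m) (suc m * (suc r * suc k * suc n))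
                  (gap-bound {suc n} {suc k} {suc r} {suc m} {E} {D} {Q} {V} {partBound (suc r) (suc k)}
                     2m≡nr (sum-vol² G part regular) (n≤edgesIn+heavyCount regular 2≤r)
                     heavyCount*k≤n (sum-size²≤ (λ u → ≤-reflexive (regular u)))) ⟩
    (ℤ.+ (E * (suc r * suc k * suc n) + Z * suc m)) / (suc m * (suc r * suc k * suc n))
      ≡⟨ /-+ E (suc m) Z (suc r * suc k * suc n) ⟨
    (ℤ.+ E) / suc m ℚ.+ (ℤ.+ Z) / (suc r * suc k * suc n)      ∎)
  where
  open Cutting (spanningForest G) (suc k)
  open ℚ.≤-Reasoning
  E = Σ[ suc n ] (eIn G part)
  V = Σ[ suc n ] (λ c → vol G part c * vol G part c)
  Z = gap (suc r) (suc n) (suc k)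
  D = heavyCount
  Q = sum (λ c → size c * size c)
  2m≡nr : 2 * suc m ≡ suc n * suc r
  2m≡nr = subst (λ e → 2 * e ≡ suc n * suc r) edges≡ (edges-regular G regular)

open import Data.Integer using (+_)

proposition1p4 : (r n : ℕ) → 2 ≤ r → suc r ≤ n → 2 ∣ (r ℕ.* n) →
    (G : Graph n) → Regular r G → (q : ℚ) → IsModularity G q →
    let x = ((+ 2) / suc (r ℕ.∸ 1)) ℚ.- q in
      (x ℚ.≤ 0ℚ) ⊎ (x ℚ.* x ℚ.≤ (+ 24) / suc (n ℕ.∸ 1))
-- The parity hypothesis only ensures that such graphs exist; the bound does not use it.
proposition1p4 zero    _       ()  _   _ _ _       _ _
proposition1p4 (suc r) zero    _   ()  _ _ _       _ _
proposition1p4 (suc r) (suc n) 2≤r r<n _ G regular q (_ , q-max)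
  with k , gap²≤ ← choose-k 2≤r r<n
     | m , edges≡ ← edges-suc G regular
  = square≤ (/-mono-≤ 0 1 (gap (suc r) (suc n) (suc k)) (suc r * suc k * suc n) z≤n)
            (deficit≤gap G regular 2≤r edges≡ k q q-max)
            (square-/≤ (gap (suc r) (suc n) (suc k)) (suc r * suc k * suc n) 24 (suc n) gap²≤)
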